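{- For every simple type $A$, $\mathrm{ver}_A(\mathrm{gen}_A) \twoheadrightarrow \star$ in $\lambda^{\to}_{\mathfrak m}$.
   Context: Simple types: $A,B ::= \mathbf{a} \mid A\Rightarrow B$ with $\mathbf{a}$ atomic. The metacalculus $\lambda^{\to}_{\mathfrak m}$ has metaterms $M,N ::= x \mid \lambda x.M \mid M\,N \mid \star \mid (M \triangleright N) \mid \mathrm{gen}_{\mathbf{a}} \mid \mathrm{ver}_{\mathbf{a}}(M)$ for atomic $\mathbf{a}$. For arbitrary types: $\mathrm{gen}_{A\Rightarrow B} := \lambda x.(\mathrm{ver}_A(x) \triangleright \mathrm{gen}_B)$ ($x$ fresh) and $\mathrm{ver}_{A \Rightarrow B}(M) := \mathrm{ver}_B(M\,\mathrm{gen}_A)$. Reduction $\to$ is the closure under arbitrary contexts of $(\lambda x.M)\,N \to M\{x:=N\}$, $(\star \triangleright M) \to M$, $\mathrm{ver}_{\mathbf{a}}(\mathrm{gen}_{\mathbf{a}}) \to \star$; $\twoheadrightarrow$ is its reflexive-transitive closure. -}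

module Defs where

open import Data.Nat using (ℕ; zero; suc; _<ᵇ_; pred)
open import Data.Bool using (if_then_else_)
open import Relation.Binary.Construct.Closure.ReflexiveTransitive using (Star)

data Ty : Set where
  atom : ℕ → Ty
  _⇒_  : Ty → Ty → Ty
infixr 7 _⇒_

-- Metaterms of λ→_m, with de Bruijn indices for variables
-- (equivalent to named terms up to α-conversion).
data Tm : Set where
  var  : ℕ → Tm
  lam  : Tm → Tm
  app  : Tm → Tm → Tm
  star : Tm
  _▷_  : Tm → Tm → Tm
  genₐ : ℕ → Tm
  verₐ : ℕ → Tm → Tm
infixr 5 _▷_

shift : ℕ → Tm → Tm
shift c (var n)    = if n <ᵇ c then var n else var (suc n)
shift c (lam M)    = lam (shift (suc c) M)
shift c (app M N)  = app (shift c M) (shift c N)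
shift c star       = star
shift c (M ▷ N)    = shift c M ▷ shift c N
shift c (genₐ a)   = genₐ a
shift c (verₐ a M) = verₐ a (shift c M)

subst : ℕ → Tm → Tm → Tm
subst k N (var n)    = if n <ᵇ k then var n else (if k <ᵇ n then var (pred n) else N)
subst k N (lam M)    = lam (subst (suc k) (shift 0 N) M)
subst k N (app M P)  = app (subst k N M) (subst k N P)
subst k N star       = star
subst k N (M ▷ P)    = subst k N M ▷ subst k N P
subst k N (genₐ a)   = genₐ a
subst k N (verₐ a M) = verₐ a (subst k N M)

_[_] : Tm → Tm → Tm
M [ N ] = subst 0 N M

-- gen_A and ver_A(M) for arbitrary types
-- gen_{A⇒B} := λx.(ver_A(x) ▷ gen_B)   (gen_B is closed, so no shift needed)
-- ver_{A⇒B}(M) := ver_B(M gen_A)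
mutual
  gen : Ty → Tm
  gen (atom a) = genₐ a
  gen (A ⇒ B)  = lam (ver A (var 0) ▷ gen B)

  ver : Ty → Tm → Tm
  ver (atom a) M = verₐ a M
  ver (A ⇒ B) M  = ver B (app M (gen A))

data _⟶_ : Tm → Tm → Set where
  β      : ∀ {M N} → app (lam M) N ⟶ (M [ N ])
  ▷-star : ∀ {M} → (star ▷ M) ⟶ M
  ver-gen : ∀ {a} → verₐ a (genₐ a) ⟶ star
  ξ-lam  : ∀ {M M'} → M ⟶ M' → lam M ⟶ lam M'
  ξ-appˡ : ∀ {M M' N} → M ⟶ M' → app M N ⟶ app M' N
  ξ-appʳ : ∀ {M N N'} → N ⟶ N' → app M N ⟶ app M N'
  ξ-▷ˡ   : ∀ {M M' N} → M ⟶ M' → (M ▷ N) ⟶ (M' ▷ N)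
  ξ-▷ʳ   : ∀ {M N N'} → N ⟶ N' → (M ▷ N) ⟶ (M ▷ N')
  ξ-ver  : ∀ {a M M'} → M ⟶ M' → verₐ a M ⟶ verₐ a M'
infix 4 _⟶_ _↠_

_↠_ : Tm → Tm → Set
_↠_ = Star _⟶_

-- For A ⇒ B, ver_{A⇒B}(gen_{A⇒B}) = ver_B(gen_{A⇒B} gen_A), and ver_B puts its
-- argument in a reduction context, so the β-step gen_{A⇒B} gen_A → ver_A(gen_A) ▷ gen_B happens
-- under it (gen is closed, so substitution leaves gen_B and gen_A alone). The hypothesis for A
-- reduces ver_A(gen_A) ▷ gen_B to gen_B, and the hypothesis for B finishes.
module Submission where

open import Defs
open import Data.Nat using (suc)
open import Relation.Binary.PropositionalEquality using (_≡_; refl; cong; cong₂) renaming (subst to ≡-subst)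
open import Relation.Binary.PropositionalEquality.Properties using (module ≡-Reasoning)
open import Relation.Binary.Construct.Closure.ReflexiveTransitive using (ε; _◅_; _◅◅_; gmap)

mutual
  subst-gen : ∀ A k N → subst k N (gen A) ≡ gen A
  subst-gen (atom a) k N = refl
  subst-gen (A ⇒ B) k N =
    cong₂ (λ V G → lam (V ▷ G)) (subst-ver A (suc k) (shift 0 N) (var 0)) (subst-gen B (suc k) (shift 0 N))

  subst-ver : ∀ A k N M → subst k N (ver A M) ≡ ver A (subst k N M)
  subst-ver (atom a) k N M = refl
  subst-ver (A ⇒ B) k N M = begin
    subst k N (ver B (app M (gen A)))             ≡⟨ subst-ver B k N (app M (gen A)) ⟩
    ver B (app (subst k N M) (subst k N (gen A))) ≡⟨ cong (λ G → ver B (app (subst k N M) G)) (subst-gen A k N) ⟩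
    ver B (app (subst k N M) (gen A))             ∎
    where open ≡-Reasoning

gen-⇒-β : ∀ A B N → app (gen (A ⇒ B)) N ⟶ (ver A N ▷ gen B)
gen-⇒-β A B N = ≡-subst (app (gen (A ⇒ B)) N ⟶_) contractum≡ β
  where
  contractum≡ : (ver A (var 0) ▷ gen B) [ N ] ≡ (ver A N ▷ gen B)
  contractum≡ = cong₂ _▷_ (subst-ver A 0 N (var 0)) (subst-gen B 0 N)

ver-cong : ∀ A {M M'} → M ⟶ M' → ver A M ⟶ ver A M'
ver-cong (atom a) M⟶M' = ξ-ver M⟶M'
ver-cong (A ⇒ B)  M⟶M' = ver-cong B (ξ-appˡ M⟶M')

ver-cong* : ∀ A {M M'} → M ↠ M' → ver A M ↠ ver A M'
ver-cong* A = gmap (ver A) (ver-cong A)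

▷-congˡ* : ∀ {M M' N} → M ↠ M' → (M ▷ N) ↠ (M' ▷ N)
▷-congˡ* = gmap (_▷ _) ξ-▷ˡ

lemma3p8 : (A : Ty) → ver A (gen A) ↠ star
lemma3p8 (atom a) = ver-gen ◅ ε
lemma3p8 (A ⇒ B) =
  ver-cong B (gen-⇒-β A B (gen A))
    ◅ ver-cong* B (▷-congˡ* (lemma3p8 A) ◅◅ ▷-star ◅ ε)
    ◅◅ lemma3p8 B
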